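{- For $n\ge 1$, $p_{n;=n}^{n}=p_{n-1}$, and for any $k\geq 1$ and $n\geq k+1$, $p_{n;=n-k}^{n-k}=p_{n-1;\leq n-k}$. Moreover, for any $k\geq 1$, $n\geq k+2$ and $1\le l\leq n-k-1$, $$p_{n;=n-k}^l=p_{n;=n-k+1}^l+\binom{n-1}{k+1}p_{n-k-1}^l-\sum_{i=1}^k\binom{n-1}{i}p_{n-i;=n-k}^l.$$
   Context: There are $n$ parking spaces in a line numbered $1,\dots,n$; $n$ cars arrive in order, car $j$ has preference $a_j\in[n]$ and parks in the first unoccupied space numbered $\geq a_j$, if any; $(a_1,\dots,a_n)$ is a parking function if all cars park. $p_n=(n+1)^{n-1}$ is the number of parking functions of length $n$; $p_n^l$ the number with $a_1=l$; $p_{n;\le s}$ the number with all $a_j\le s$; $p_{n;=s}^l$ the number with $a_1=l$, all $a_j\leq s$, and $a_j=s$ for some $j$. -}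

module Defs where

open import Data.Nat using (ℕ; zero; suc; _+_; _∸_; _≤ᵇ_; _≡ᵇ_)
open import Data.Bool using (Bool; true; false; _∧_; if_then_else_)
open import Data.Maybe using (Maybe; just; nothing)
open import Data.List using (List; []; _∷_; map; concatMap; applyUpTo)
open import Data.Integer using (ℤ; +_; _-_) renaming (_+_ to _+ℤ_)
open import Data.Nat.Combinatorics using (_C_)
open import Relation.Nullary.Decidable using (does)
open import Relation.Binary.PropositionalEquality using (_≡_)

-- Parking spaces are numbered 1..n; a preference sequence (a₁,…,aₙ) is a
-- list of naturals.

elemᵇ : ℕ → List ℕ → Bool
elemᵇ x []       = false
elemᵇ x (y ∷ ys) = (x ≡ᵇ y) Data.Bool.∨ elemᵇ x ys

firstFree : (n : ℕ) → List ℕ → (s fuel : ℕ) → Maybe ℕ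
firstFree n occ s zero = nothing
firstFree n occ s (suc fuel) =
  if (s ≤ᵇ n) ∧ Data.Bool.not (elemᵇ s occ)
  then just s
  else firstFree n occ (suc s) fuel

allPark : (n : ℕ) → (occ : List ℕ) → List ℕ → Bool
allPark n occ [] = true
allPark n occ (a ∷ as) with firstFree n occ a (suc n)
... | nothing = false
... | just s  = allPark n (s ∷ occ) as

isPF : ℕ → List ℕ → Bool
isPF n as = allPark n [] as

range1 : ℕ → List ℕ
range1 n = applyUpTo suc n

seqs : (m n : ℕ) → List (List ℕ)
seqs zero    n = [] ∷ []
seqs (suc m) n = concatMap (λ a → map (a ∷_) (seqs m n)) (range1 n)

filterB : (List ℕ → Bool) → List (List ℕ) → List (List ℕ)
filterB P []       = []
filterB P (x ∷ xs) = if P x then x ∷ filterB P xs else filterB P xs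

countB : (List ℕ → Bool) → List (List ℕ) → ℕ
countB P []       = 0
countB P (x ∷ xs) = (if P x then 1 else 0) + countB P xs

PF : ℕ → List (List ℕ)
PF n = filterB (isPF n) (seqs n n)

firstIs : ℕ → List ℕ → Bool
firstIs l []      = false
firstIs l (a ∷ _) = a ≡ᵇ l

allLe : ℕ → List ℕ → Bool
allLe s []       = true
allLe s (a ∷ as) = (a ≤ᵇ s) ∧ allLe s as

someEq : ℕ → List ℕ → Bool
someEq s []       = false
someEq s (a ∷ as) = (a ≡ᵇ s) Data.Bool.∨ someEq s as

p : ℕ → ℕ
p n = countB (λ _ → true) (PF n)

pˡ : ℕ → ℕ → ℕ
pˡ n l = countB (firstIs l) (PF n)

p≤ : ℕ → ℕ → ℕ
p≤ n s = countB (allLe s) (PF n)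

p⁼ : ℕ → ℕ → ℕ → ℕ
p⁼ n s l = countB (λ as → firstIs l as ∧ allLe s as ∧ someEq s as) (PF n)

sumℤ1 : ℕ → (ℕ → ℤ) → ℤ
sumℤ1 zero    f = + 0
sumℤ1 (suc k) f = sumℤ1 k f +ℤ f (suc k)

module Submission where

-- Running the parking process from a partly filled
--    lot shows: all cars park iff for every j the number of cars preferring
--    a space ≥ j is at most the number of free spaces ≥ j.  For the empty
--    lot, (a₁,…,aₙ) is a parking function iff #{i : aᵢ ≥ j} + j ≤ n + 1
--    whenever that number is positive ('Fits').
-- 2. Removal lemma.  If every entry is ≤ v and v occurs i times, then α is a
--    parking function of length L iff deleting the v's leaves a parking
--    function of length L - i and v + i ≤ L + 1 (or i = 0).
-- 3. Counting.  After general lemmas on counting sequences of [N]ᵐ (by first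
--    entry, by a test, by the value of a statistic), binomial counting:
--    sequences with exactly i entries v whose v-free part has property R
--    number C(m,i) times the v-free sequences of length m - i with R.
-- 4. Parts one and two: a first entry s = max forces the tail to be a
--    parking function of length n - 1 with entries ≤ s.
-- 5. Part three, with t = n - k - 1, s = t + 1 = n - k, W = s + 1, l ≤ t:
--    the tails β ∈ [W]^(n-1) of parking functions l ∷ β are split once by
--    whether s occurs and once by whether W occurs.  Erasing the W's (at
--    most k of them) resp. the s's (at most k + 1) and counting binomially
--    expresses the four parts through p_{n-i;=s}^l, p_{n;=W}^l, p_t^l and
--    the numbers aᵢ of tails of length n - 1 - i with entries ≤ t.  The aᵢ
--    cancel between the two splittings, leaving the identity in ℕ, which is
--    finally rewritten in the integer form of the statement.

open import Defs
open import Data.Nat using (ℕ; zero; suc; _≤_; _<_; _+_; _∸_; _*_; _⊓_; _≤ᵇ_; _≡ᵇ_; z≤n; s≤s; z<s)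
open import Data.Nat.Properties
open import Data.Nat.Combinatorics using (_C_; k>n⇒nCk≡0; nCk+nC[k+1]≡[n+1]C[k+1])
open import Data.Nat.Tactic.RingSolver using (solve-∀)
open import Algebra.Properties.CommutativeSemigroup +-commutativeSemigroup using (x∙yz≈y∙xz; interchange)
open import Data.Integer using (ℤ; +_; _-_; _⊖_) renaming (_+_ to _+ℤ_; _*_ to _*ℤ_)
import Data.Integer.Properties as ℤP
open import Data.Bool using (Bool; true; false; _∧_; _∨_; not; if_then_else_; T)
open import Data.Bool.Properties using (∧-zeroʳ; ∧-identityʳ; ∧-assoc)
open import Data.Maybe using (just; nothing)
open import Data.List using (List; []; _∷_; length; _++_; map; concatMap; applyUpTo)
open import Data.Product using (Σ; _×_; _,_; proj₁; proj₂)
open import Data.Sum using (_⊎_; inj₁; inj₂)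
open import Data.Empty using (⊥-elim)
open import Data.Unit using (tt)
open import Relation.Nullary using (yes; no; ¬_)
open import Relation.Binary.PropositionalEquality
  using (_≡_; _≢_; refl; sym; trans; cong; cong₂; subst; subst₂; module ≡-Reasoning)

≤ᵇ-true⇒≤ : ∀ {m n} → (m ≤ᵇ n) ≡ true → m ≤ n
≤ᵇ-true⇒≤ {m} {n} e = ≤ᵇ⇒≤ m n (subst T (sym e) tt)

≤⇒≤ᵇ-true : ∀ {m n} → m ≤ n → (m ≤ᵇ n) ≡ true
≤⇒≤ᵇ-true {m} {n} p with m ≤ᵇ n | ≤⇒≤ᵇ p
... | true | _ = refl

>⇒≤ᵇ-false : ∀ {m n} → n < m → (m ≤ᵇ n) ≡ false
>⇒≤ᵇ-false {m} {n} p with m ≤ᵇ n in e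
... | true  = ⊥-elim (<⇒≱ p (≤ᵇ-true⇒≤ e))
... | false = refl

≡⇒≡ᵇ-true : ∀ {m n} → m ≡ n → (m ≡ᵇ n) ≡ true
≡⇒≡ᵇ-true {m} {n} p with m ≡ᵇ n | ≡⇒≡ᵇ m n p
... | true | _ = refl

≢⇒≡ᵇ-false : ∀ {m n} → m ≢ n → (m ≡ᵇ n) ≡ false
≢⇒≡ᵇ-false {m} {n} p with m ≡ᵇ n in e
... | true  = ⊥-elim (p (≡ᵇ⇒≡ m n (subst T (sym e) tt)))
... | false = refl

≡ᵇ-refl : ∀ m → (m ≡ᵇ m) ≡ true
≡ᵇ-refl m = ≡⇒≡ᵇ-true {m} refl

∧-true : ∀ {a b} → (a ∧ b) ≡ true → (a ≡ true) × (b ≡ true)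
∧-true {true} {true} _ = refl , refl

∧-∧-false : ∀ a b → (a ∧ (b ∧ false)) ≡ false
∧-∧-false a b = trans (cong (_∧_ a) (∧-zeroʳ b)) (∧-zeroʳ a)

bool-ext : ∀ {a b : Bool} → (a ≡ true → b ≡ true) → (b ≡ true → a ≡ true) → a ≡ b
bool-ext {true}  f g = sym (f refl)
bool-ext {false} {true} f g = g refl
bool-ext {false} {false} f g = refl

[_] : Bool → ℕ
[ b ] = if b then 1 else 0

-- atLeast j as = #{i : aᵢ ≥ j}, the cars that can only park in spaces ≥ j.

atLeast : ℕ → List ℕ → ℕ
atLeast j []       = 0
atLeast j (a ∷ as) = [ j ≤ᵇ a ] + atLeast j as

atLeast-≥ : ∀ {j a} as → j ≤ a → atLeast j (a ∷ as) ≡ suc (atLeast j as)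
atLeast-≥ as p rewrite ≤⇒≤ᵇ-true p = refl

atLeast-< : ∀ {j a} as → a < j → atLeast j (a ∷ as) ≡ atLeast j as
atLeast-< as p rewrite >⇒≤ᵇ-false p = refl

atLeast-antitone : ∀ {j j'} as → j ≤ j' → atLeast j' as ≤ atLeast j as
atLeast-antitone [] p = z≤n
atLeast-antitone {j} {j'} (a ∷ as) p with j' ≤? a | j ≤? a
... | yes q | _ rewrite atLeast-≥ as q | atLeast-≥ as (≤-trans p q) = s≤s (atLeast-antitone as p)
... | no q | yes r rewrite atLeast-< as (≰⇒> q) | atLeast-≥ as r = m≤n⇒m≤1+n (atLeast-antitone as p)
... | no q | no r rewrite atLeast-< as (≰⇒> q) | atLeast-< as (≰⇒> r) = atLeast-antitone as p

atLeast-cons : ∀ j a as → atLeast j as ≤ atLeast j (a ∷ as)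
atLeast-cons j a as = m≤n+m (atLeast j as) _

allLe-cons : ∀ v a β → allLe v (a ∷ β) ≡ true → (a ≤ v) × (allLe v β ≡ true)
allLe-cons v a β e with ∧-true {a ≤ᵇ v} e
... | a≤v , rest = ≤ᵇ-true⇒≤ a≤v , rest

allLe-∷ : ∀ {v a} β → a ≤ v → allLe v β ≡ true → allLe v (a ∷ β) ≡ true
allLe-∷ β a≤v e rewrite ≤⇒≤ᵇ-true a≤v = e

allLe-mono : ∀ {t W} β → t ≤ W → allLe t β ≡ true → allLe W β ≡ true
allLe-mono []      t≤W e = refl
allLe-mono (a ∷ β) t≤W e with allLe-cons _ a β e
... | a≤t , e' = allLe-∷ β (≤-trans a≤t t≤W) (allLe-mono β t≤W e')

-- Free spaces.  'isFree n occ q' says space q ≤ n is not in the occupied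
-- list; 'freeFrom n occ q f' counts free spaces among q, …, q + f - 1 and
-- 'free n occ j' the free spaces ≥ j (the window q ≤ j + n covers them all).

isFree : ℕ → List ℕ → ℕ → Bool
isFree n occ q = (q ≤ᵇ n) ∧ not (elemᵇ q occ)

[isFree] : ℕ → List ℕ → ℕ → ℕ
[isFree] n occ q = [ isFree n occ q ]

freeFrom : ℕ → List ℕ → ℕ → ℕ → ℕ
freeFrom n occ q zero    = 0
freeFrom n occ q (suc f) = [isFree] n occ q + freeFrom n occ (suc q) f

free : ℕ → List ℕ → ℕ → ℕ
free n occ j = freeFrom n occ j (suc n)

[isFree]-beyond : ∀ n occ q → n < q → [isFree] n occ q ≡ 0
[isFree]-beyond n occ q p rewrite >⇒≤ᵇ-false p = refl

freeFrom-stable : ∀ n occ q f → n < q + f → freeFrom n occ q f ≡ freeFrom n occ q (suc f)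
freeFrom-stable n occ q zero p
  rewrite [isFree]-beyond n occ q (subst (n <_) (+-identityʳ q) p) = refl
freeFrom-stable n occ q (suc f) p =
  cong (_+_ ([isFree] n occ q)) (freeFrom-stable n occ (suc q) f (subst (n <_) (+-suc q f) p))

free-step : ∀ n occ j → free n occ j ≡ [isFree] n occ j + free n occ (suc j)
free-step n occ j =
  cong (_+_ ([isFree] n occ j)) (freeFrom-stable n occ (suc j) n (s≤s (m≤n+m n j)))

free-skip : ∀ n occ a d → (∀ q → a ≤ q → q < a + d → [isFree] n occ q ≡ 0) →
            free n occ (a + d) ≡ free n occ a
free-skip n occ a zero h rewrite +-identityʳ a = refl
free-skip n occ a (suc d) h = begin
  free n occ (a + suc d)   ≡⟨ cong (free n occ) (+-suc a d) ⟩
  free n occ (suc (a + d)) ≡⟨ sym (trans (free-step n occ (a + d)) a+d-occupied) ⟩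
  free n occ (a + d)       ≡⟨ free-skip n occ a d (λ q p r → h q p (subst (q <_) (sym (+-suc a d)) (m<n⇒m<1+n r))) ⟩
  free n occ a             ∎
  where
  open ≡-Reasoning
  a+d-occupied : [isFree] n occ (a + d) + free n occ (suc (a + d)) ≡ free n occ (suc (a + d))
  a+d-occupied = cong (_+ free n occ (suc (a + d)))
    (h (a + d) (m≤m+n a d) (subst (a + d <_) (sym (+-suc a d)) (n<1+n (a + d))))

[isFree]-other : ∀ n occ s q → q ≢ s → [isFree] n (s ∷ occ) q ≡ [isFree] n occ q
[isFree]-other n occ s q p rewrite ≢⇒≡ᵇ-false p = refl

freeFrom-occupy-below : ∀ n occ s q f → s < q → freeFrom n (s ∷ occ) q f ≡ freeFrom n occ q f
freeFrom-occupy-below n occ s q zero p = refl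
freeFrom-occupy-below n occ s q (suc f) p =
  cong₂ _+_ ([isFree]-other n occ s q (λ e → <-irrefl (sym e) p))
            (freeFrom-occupy-below n occ s (suc q) f (m<n⇒m<1+n p))

freeFrom-occupy : ∀ n occ s q f → isFree n occ s ≡ true → q ≤ s → s < q + f →
                  suc (freeFrom n (s ∷ occ) q f) ≡ freeFrom n occ q f
freeFrom-occupy n occ s q zero fs qs p = ⊥-elim (<⇒≱ (subst (s <_) (+-identityʳ q) p) qs)
freeFrom-occupy n occ s q (suc f) fs qs p with q ≟ s
... | yes refl rewrite ≡ᵇ-refl q | ∧-zeroʳ (q ≤ᵇ n) | fs =
  cong suc (freeFrom-occupy-below n occ q (suc q) f (n<1+n q))
... | no q≢s = trans (sym (+-suc ([isFree] n (s ∷ occ) q) _))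
       (cong₂ _+_ ([isFree]-other n occ s q q≢s)
         (freeFrom-occupy n occ s (suc q) f fs (≤∧≢⇒< qs q≢s) (subst (s <_) (+-suc q f) p)))

free-occupy-≥ : ∀ n occ s j → isFree n occ s ≡ true → j ≤ s →
                suc (free n (s ∷ occ) j) ≡ free n occ j
free-occupy-≥ n occ s j fs js = freeFrom-occupy n occ s j (suc n) fs js
  (≤-trans (s≤s s≤n) (subst (suc n ≤_) (sym (+-suc j n)) (s≤s (m≤n+m n j))))
  where
  s≤n : s ≤ n
  s≤n = ≤ᵇ-true⇒≤ (proj₁ (∧-true fs))

free-occupy-< : ∀ n occ s j → s < j → free n (s ∷ occ) j ≡ free n occ j
free-occupy-< n occ s j p = freeFrom-occupy-below n occ s j (suc n) p

free-occupy-≤ : ∀ n occ s j → isFree n occ s ≡ true → free n (s ∷ occ) j ≤ free n occ j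
free-occupy-≤ n occ s j fs with j ≤? s
... | yes js = subst (free n (s ∷ occ) j ≤_) (free-occupy-≥ n occ s j fs js) (n≤1+n _)
... | no js  = ≤-reflexive (free-occupy-< n occ s j (≰⇒> js))

freeFrom-empty : ∀ n q f → freeFrom n [] q f ≡ (suc n ∸ q) ⊓ f
freeFrom-empty n q zero = sym (⊓-zeroʳ (suc n ∸ q))
freeFrom-empty n q (suc f) with q ≤? n
... | yes qn rewrite ≤⇒≤ᵇ-true qn | +-∸-assoc 1 qn = cong suc (freeFrom-empty n (suc q) f)
... | no qn rewrite >⇒≤ᵇ-false (≰⇒> qn) | m≤n⇒m∸n≡0 (≰⇒> qn) =
  trans (freeFrom-empty n (suc q) f) (cong (_⊓ f) (m≤n⇒m∸n≡0 (<⇒≤ (≰⇒> qn))))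

free-empty : ∀ n j → free n [] j ≡ suc n ∸ j
free-empty n j = trans (freeFrom-empty n j (suc n)) (m≤n⇒m⊓n≡m (m∸n≤m (suc n) j))

firstFree-nothing : ∀ n occ q f → firstFree n occ q f ≡ nothing → freeFrom n occ q f ≡ 0
firstFree-nothing n occ q zero e = refl
firstFree-nothing n occ q (suc f) e with isFree n occ q
firstFree-nothing n occ q (suc f) () | true
... | false = firstFree-nothing n occ (suc q) f e

record FirstFree (n : ℕ) (occ : List ℕ) (q s : ℕ) : Set where
  field
    start≤ : q ≤ s
    isFree-s : isFree n occ s ≡ true
    skipped : ∀ r → q ≤ r → r < s → [isFree] n occ r ≡ 0

firstFree-just : ∀ n occ q f s → firstFree n occ q f ≡ just s → FirstFree n occ q s
firstFree-just n occ q zero s ()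
firstFree-just n occ q (suc f) s e with isFree n occ q in fq
firstFree-just n occ q (suc f) .q refl | true =
  record { start≤ = ≤-refl ; isFree-s = fq ; skipped = λ r p1 p2 → ⊥-elim (<⇒≱ p2 p1) }
... | false = record { start≤ = ≤-trans (n≤1+n q) start≤ ; isFree-s = isFree-s ; skipped = skip }
  where
  open FirstFree (firstFree-just n occ (suc q) f s e)
  skip : ∀ r → q ≤ r → r < s → [isFree] n occ r ≡ 0
  skip r p1 p2 with q ≟ r
  ... | yes refl = cong [_] fq
  ... | no ne = skipped r (≤∧≢⇒< p1 ne) p2

allPark⇒demand≤free : ∀ n occ as → allPark n occ as ≡ true → ∀ j → atLeast j as ≤ free n occ j
allPark⇒demand≤free n occ [] e j = z≤n
allPark⇒demand≤free n occ (a ∷ as) e j with firstFree n occ a (suc n) in ff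
allPark⇒demand≤free n occ (a ∷ as) () j | nothing
... | just s with j ≤? a
... | yes j≤a rewrite atLeast-≥ as j≤a =
  subst (suc (atLeast j as) ≤_) (free-occupy-≥ n occ s j isFree-s (≤-trans j≤a start≤))
    (s≤s (allPark⇒demand≤free n (s ∷ occ) as e j))
  where open FirstFree (firstFree-just n occ a (suc n) s ff)
... | no j≰a rewrite atLeast-< as (≰⇒> j≰a) =
  ≤-trans (allPark⇒demand≤free n (s ∷ occ) as e j) (free-occupy-≤ n occ s j isFree-s)
  where open FirstFree (firstFree-just n occ a (suc n) s ff)

-- If car a parks in s and the criterion held before, it holds for the
-- remaining cars in the new lot: for a < j ≤ s the spaces a, …, j - 1 were
-- all occupied, so the free spaces ≥ j are those ≥ a.
demand≤free-after-parking : ∀ n occ a as s → FirstFree n occ a s →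
  (∀ j → atLeast j (a ∷ as) ≤ free n occ j) → ∀ j → atLeast j as ≤ free n (s ∷ occ) j
demand≤free-after-parking n occ a as s ff H j with j ≤? a | j ≤? s
... | yes j≤a | _ = ≤-pred (subst (_≤ suc (free n (s ∷ occ) j)) (atLeast-≥ as j≤a)
      (subst (atLeast j (a ∷ as) ≤_) (sym (free-occupy-≥ n occ s j isFree-s (≤-trans j≤a start≤))) (H j)))
  where open FirstFree ff
... | no j≰a | no j≰s = subst (atLeast j as ≤_) (sym (free-occupy-< n occ s j (≰⇒> j≰s)))
      (≤-trans (atLeast-cons j a as) (H j))
... | no j≰a | yes j≤s with m≤n⇒∃[o]m+o≡n (<⇒≤ (≰⇒> j≰a))
...   | d , refl = ≤-trans (atLeast-antitone as (m≤m+n a d)) (≤-pred (begin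
  suc (atLeast a as)               ≡⟨ atLeast-≥ as ≤-refl ⟨
  atLeast a (a ∷ as)               ≤⟨ H a ⟩
  free n occ a                     ≡⟨ free-skip n occ a d (λ r p q → skipped r p (<-≤-trans q j≤s)) ⟨
  free n occ (a + d)               ≡⟨ free-occupy-≥ n occ s (a + d) isFree-s j≤s ⟨
  suc (free n (s ∷ occ) (a + d))   ∎))
  where
  open FirstFree ff
  open ≤-Reasoning

demand≤free⇒allPark : ∀ n occ as → (∀ j → atLeast j as ≤ free n occ j) → allPark n occ as ≡ true
demand≤free⇒allPark n occ [] H = refl
demand≤free⇒allPark n occ (a ∷ as) H with firstFree n occ a (suc n) in ff
... | nothing = ⊥-elim (1+n≰0 (begin
  suc (atLeast a as)       ≡⟨ atLeast-≥ as ≤-refl ⟨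
  atLeast a (a ∷ as)       ≤⟨ H a ⟩
  free n occ a             ≡⟨ firstFree-nothing n occ a (suc n) ff ⟩
  0                        ∎))
  where
  open ≤-Reasoning
  1+n≰0 : ∀ {x} → ¬ (suc x ≤ 0)
  1+n≰0 ()
... | just s = demand≤free⇒allPark n (s ∷ occ) as
  (demand≤free-after-parking n occ a as s (firstFree-just n occ a (suc n) s ff) H)

Fits : ℕ → List ℕ → Set
Fits L α = ∀ j → 0 < atLeast j α → atLeast j α + j ≤ suc L

isPF⇒Fits : ∀ n α → isPF n α ≡ true → Fits n α
isPF⇒Fits n α e j pos = m≤o∸n⇒m+n≤o _ j≤1+n demand≤
  where
  demand≤ : atLeast j α ≤ suc n ∸ j
  demand≤ = subst (atLeast j α ≤_) (free-empty n j) (allPark⇒demand≤free n [] α e j)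
  j≤1+n : j ≤ suc n
  j≤1+n with j ≤? suc n
  ... | yes p = p
  ... | no p = ⊥-elim (<⇒≱ pos (subst (atLeast j α ≤_) (m≤n⇒m∸n≡0 (<⇒≤ (≰⇒> p))) demand≤))

Fits⇒isPF : ∀ n α → Fits n α → isPF n α ≡ true
Fits⇒isPF n α fits = demand≤free⇒allPark n [] α demand≤
  where
  demand≤ : ∀ j → atLeast j α ≤ free n [] j
  demand≤ j with atLeast j α in c
  ... | zero  = z≤n
  ... | suc x = subst (suc x ≤_) (sym (free-empty n j))
                  (m+n≤o⇒m≤o∸n (suc x) (subst (λ y → y + j ≤ suc n) c (fits j (subst (0 <_) (sym c) z<s))))

mult : ℕ → List ℕ → ℕ
mult v []       = 0
mult v (a ∷ as) = [ a ≡ᵇ v ] + mult v as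

erase : ℕ → List ℕ → List ℕ
erase v []       = []
erase v (a ∷ as) = if a ≡ᵇ v then erase v as else a ∷ erase v as

length-erase : ∀ v α → length (erase v α) + mult v α ≡ length α
length-erase v [] = refl
length-erase v (a ∷ α) with a ≡ᵇ v
... | true  = trans (+-suc _ _) (cong suc (length-erase v α))
... | false = cong suc (length-erase v α)

atLeast-erase : ∀ v j α → allLe v α ≡ true → j ≤ v → atLeast j α ≡ atLeast j (erase v α) + mult v α
atLeast-erase v j [] e p = refl
atLeast-erase v j (a ∷ α) e p with allLe-cons v a α e
... | a≤v , e' with a ≟ v
... | yes refl rewrite ≡ᵇ-refl a | atLeast-≥ α p =
  trans (cong suc (atLeast-erase v j α e' p)) (sym (+-suc _ _))
... | no a≢v rewrite ≢⇒≡ᵇ-false a≢v with j ≤? a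
...   | yes q rewrite atLeast-≥ α q | atLeast-≥ (erase v α) q = cong suc (atLeast-erase v j α e' p)
...   | no q rewrite atLeast-< α (≰⇒> q) | atLeast-< (erase v α) (≰⇒> q) = atLeast-erase v j α e' p

atLeast-above-max : ∀ v j α → allLe v α ≡ true → v < j → atLeast j α ≡ 0
atLeast-above-max v j [] e p = refl
atLeast-above-max v j (a ∷ α) e p with allLe-cons v a α e
... | a≤v , e' rewrite atLeast-< α (≤-<-trans a≤v p) = atLeast-above-max v j α e' p

atLeast-erase-max : ∀ v j α → allLe v α ≡ true → v ≤ j → atLeast j (erase v α) ≡ 0
atLeast-erase-max v j α e p = n≤0⇒n≡0 (≤-trans (atLeast-antitone (erase v α) p) (≤-reflexive (below v α e)))
  where
  below : ∀ v α → allLe v α ≡ true → atLeast v (erase v α) ≡ 0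
  below v [] e = refl
  below v (a ∷ α) e with allLe-cons v a α e
  ... | a≤v , e' with a ≟ v
  ... | yes refl rewrite ≡ᵇ-refl a = below v α e'
  ... | no a≢v rewrite ≢⇒≡ᵇ-false a≢v | atLeast-< (erase v α) (≤∧≢⇒< a≤v a≢v) = below v α e'

cancel-erased : ∀ c i j L' → c + i + j ≤ suc (i + L') → c + j ≤ suc L'
cancel-erased c i j L' p = +-cancelˡ-≤ i _ _ (subst₂ _≤_ (reorder c i j) (sym (+-suc i L')) p)
  where
  reorder : ∀ c i j → c + i + j ≡ i + (c + j)
  reorder = solve-∀

add-erased : ∀ c i j L' → c + j ≤ suc L' → c + i + j ≤ suc (i + L')
add-erased c i j L' p = subst₂ _≤_ (reorder c i j) (+-suc i L') (+-monoʳ-≤ i p)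
  where
  reorder : ∀ c i j → i + (c + j) ≡ c + i + j
  reorder = solve-∀

module _ (v : ℕ) (α : List ℕ) (L' : ℕ) (max : allLe v α ≡ true) where
  private
    i = mult v α

  Fits-erase : Fits (i + L') α → Fits L' (erase v α) × ((i ≡ 0) ⊎ (v + i ≤ suc (i + L')))
  Fits-erase fits = fits' , v-block
    where
    fits' : Fits L' (erase v α)
    fits' j pos with j ≤? v
    ... | no j≰v = ⊥-elim (<⇒≱ pos (≤-reflexive (atLeast-erase-max v j α max (<⇒≤ (≰⇒> j≰v)))))
    ... | yes j≤v = cancel-erased _ i j L'
      (subst (λ x → x + j ≤ suc (i + L')) split
        (fits j (subst (0 <_) (sym split) (≤-trans pos (m≤m+n _ i)))))
      where
      split : atLeast j α ≡ atLeast j (erase v α) + i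
      split = atLeast-erase v j α max j≤v
    v-block : (i ≡ 0) ⊎ (v + i ≤ suc (i + L'))
    v-block with i ≟ 0
    ... | yes i≡0 = inj₁ i≡0
    ... | no i≢0 = inj₂ (≤-trans (subst (_≤ atLeast v α + v) (+-comm i v) (+-monoˡ-≤ v i≤))
                                 (fits v (<-≤-trans (n≢0⇒n>0 i≢0) i≤)))
      where
      i≤ : i ≤ atLeast v α
      i≤ = subst (i ≤_) (sym (atLeast-erase v v α max ≤-refl)) (m≤n+m i _)

  erase-Fits : Fits L' (erase v α) → (i ≡ 0) ⊎ (v + i ≤ suc (i + L')) → Fits (i + L') α
  erase-Fits fits' v-block j pos with j ≤? v
  ... | no j≰v = ⊥-elim (<⇒≱ pos (≤-reflexive (atLeast-above-max v j α max (≰⇒> j≰v))))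
  ... | yes j≤v rewrite atLeast-erase v j α max j≤v = fits-j v-block
    where
    fits-j : (i ≡ 0) ⊎ (v + i ≤ suc (i + L')) → atLeast j (erase v α) + i + j ≤ suc (i + L')
    fits-j (inj₁ i≡0) rewrite i≡0 | +-identityʳ (atLeast j (erase v α)) =
      fits' j (subst (0 <_) (trans (cong (_+_ (atLeast j (erase v α))) i≡0) (+-identityʳ _)) pos)
    fits-j (inj₂ v+i≤) with atLeast j (erase v α) in c
    ... | zero  = ≤-trans (+-monoʳ-≤ i j≤v) (subst (_≤ suc (i + L')) (+-comm v i) v+i≤)
    ... | suc x = add-erased (suc x) i j L'
                    (subst (λ y → y + j ≤ suc L') c (fits' j (subst (0 <_) (sym c) z<s)))

  isPF-erase : ∀ K → v + K ≡ suc (i + L') → ((i ≤ᵇ K) ∧ isPF L' (erase v α)) ≡ isPF (i + L') α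
  isPF-erase K v+K = bool-ext to from
    where
    i≤K : (i ≡ 0) ⊎ (v + i ≤ suc (i + L')) → i ≤ K
    i≤K (inj₁ i≡0) = subst (_≤ K) (sym i≡0) z≤n
    i≤K (inj₂ p) = +-cancelˡ-≤ v i K (subst (v + i ≤_) (sym v+K) p)
    to : ((i ≤ᵇ K) ∧ isPF L' (erase v α)) ≡ true → isPF (i + L') α ≡ true
    to h with ∧-true {i ≤ᵇ K} h
    ... | i≤ᵇK , pf = Fits⇒isPF (i + L') α (erase-Fits (isPF⇒Fits L' (erase v α) pf)
                        (inj₂ (subst (v + i ≤_) v+K (+-monoʳ-≤ v (≤ᵇ-true⇒≤ i≤ᵇK)))))
    from : isPF (i + L') α ≡ true → ((i ≤ᵇ K) ∧ isPF L' (erase v α)) ≡ true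
    from h with Fits-erase (isPF⇒Fits (i + L') α h)
    ... | fits' , v-block rewrite ≤⇒≤ᵇ-true (i≤K v-block) = Fits⇒isPF L' (erase v α) fits'

isPF-erase-tail : ∀ v l β K → l < v → allLe v β ≡ true → v + K ≡ suc (suc (length β)) →
  ((mult v β ≤ᵇ K) ∧ isPF (suc (length (erase v β))) (l ∷ erase v β)) ≡ isPF (suc (length β)) (l ∷ β)
isPF-erase-tail v l β K l<v max v+K
  with isPF-erase v (l ∷ β) (suc (length (erase v β))) (allLe-∷ β (<⇒≤ l<v) max) K
... | lemma rewrite ≢⇒≡ᵇ-false (<⇒≢ l<v) | +-suc (mult v β) (length (erase v β))
                  | +-comm (mult v β) (length (erase v β)) | length-erase v β = lemma v+K

isPF-max-first : ∀ m s β → s ≤ suc m → allLe s β ≡ true → isPF (suc m) (s ∷ β) ≡ isPF m β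
isPF-max-first m s β s≤1+m max = bool-ext to from
  where
  to : isPF (suc m) (s ∷ β) ≡ true → isPF m β ≡ true
  to h = Fits⇒isPF m β fits
    where
    fits : Fits m β
    fits j pos with j ≤? s
    ... | yes j≤s = ≤-pred (subst (λ x → x + j ≤ suc (suc m)) (atLeast-≥ β j≤s)
                     (isPF⇒Fits (suc m) (s ∷ β) h j (subst (0 <_) (sym (atLeast-≥ β j≤s)) z<s)))
    ... | no j≰s = ⊥-elim (<⇒≱ pos (≤-reflexive (atLeast-above-max s j β max (≰⇒> j≰s))))
  from : isPF m β ≡ true → isPF (suc m) (s ∷ β) ≡ true
  from h = Fits⇒isPF (suc m) (s ∷ β) fits
    where
    fits : Fits (suc m) (s ∷ β)
    fits j pos with j ≤? s
    ... | no j≰s = ⊥-elim (<⇒≱ pos (≤-reflexive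
                    (trans (atLeast-< β (≰⇒> j≰s)) (atLeast-above-max s j β max (≰⇒> j≰s)))))
    ... | yes j≤s rewrite atLeast-≥ β j≤s with atLeast j β in c
    ...   | zero  = s≤s (≤-trans j≤s s≤1+m)
    ...   | suc x = s≤s (subst (λ y → y + j ≤ suc m) c (isPF⇒Fits m β h j (subst (0 <_) (sym c) z<s)))

sumBelow : ℕ → (ℕ → ℕ) → ℕ
sumBelow zero    f = 0
sumBelow (suc N) f = f 0 + sumBelow N (λ a → f (suc a))

sumBelow-ext : ∀ N f g → (∀ a → a < N → f a ≡ g a) → sumBelow N f ≡ sumBelow N g
sumBelow-ext zero    f g h = refl
sumBelow-ext (suc N) f g h = cong₂ _+_ (h 0 z<s) (sumBelow-ext N _ _ (λ a a<N → h (suc a) (s≤s a<N)))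

sumBelow-zero : ∀ N f → (∀ a → a < N → f a ≡ 0) → sumBelow N f ≡ 0
sumBelow-zero zero    f h = refl
sumBelow-zero (suc N) f h rewrite h 0 z<s = sumBelow-zero N _ (λ a a<N → h (suc a) (s≤s a<N))

sumBelow-truncate : ∀ N v f → v ≤ N → (∀ a → v ≤ a → a < N → f a ≡ 0) → sumBelow N f ≡ sumBelow v f
sumBelow-truncate N zero f _ h = sumBelow-zero N f (λ a a<N → h a z≤n a<N)
sumBelow-truncate (suc N) (suc v) f (s≤s v≤N) h =
  cong (_+_ (f 0)) (sumBelow-truncate N v _ v≤N (λ a v≤a a<N → h (suc a) (s≤s v≤a) (s≤s a<N)))

sumBelow-pick : ∀ N v f → v < N → sumBelow N f ≡ f v + sumBelow N (λ a → if a ≡ᵇ v then 0 else f a)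
sumBelow-pick (suc N) zero f _ = refl
sumBelow-pick (suc N) (suc v) f (s≤s v<N) rewrite sumBelow-pick N v (λ a → f (suc a)) v<N =
  x∙yz≈y∙xz (f 0) (f (suc v)) _

sumBelow-*ˡ : ∀ N k f → sumBelow N (λ a → k * f a) ≡ k * sumBelow N f
sumBelow-*ˡ zero    k f = sym (*-zeroʳ k)
sumBelow-*ˡ (suc N) k f = trans (cong (_+_ (k * f 0)) (sumBelow-*ˡ N k _)) (sym (*-distribˡ-+ k _ _))

countB-++ : ∀ P (xs ys : List (List ℕ)) → countB P (xs ++ ys) ≡ countB P xs + countB P ys
countB-++ P []       ys = refl
countB-++ P (x ∷ xs) ys =
  trans (cong (_+_ [ P x ]) (countB-++ P xs ys)) (sym (+-assoc [ P x ] (countB P xs) (countB P ys)))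

countB-map-∷ : ∀ P a (ys : List (List ℕ)) → countB P (map (a ∷_) ys) ≡ countB (λ β → P (a ∷ β)) ys
countB-map-∷ P a []       = refl
countB-map-∷ P a (y ∷ ys) = cong (_+_ _) (countB-map-∷ P a ys)

countB-cong : ∀ P Q (xs : List (List ℕ)) → (∀ x → P x ≡ Q x) → countB P xs ≡ countB Q xs
countB-cong P Q []       h = refl
countB-cong P Q (x ∷ xs) h = cong₂ _+_ (cong [_] (h x)) (countB-cong P Q xs h)

countB-false : ∀ P (xs : List (List ℕ)) → (∀ x → P x ≡ false) → countB P xs ≡ 0
countB-false P []       h = refl
countB-false P (x ∷ xs) h rewrite h x = countB-false P xs h

countB-filterB : ∀ P Q (xs : List (List ℕ)) → countB P (filterB Q xs) ≡ countB (λ x → Q x ∧ P x) xs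
countB-filterB P Q [] = refl
countB-filterB P Q (x ∷ xs) with Q x
... | true  = cong (_+_ _) (countB-filterB P Q xs)
... | false = countB-filterB P Q xs

countB-seqs-suc : ∀ P m N →
  countB P (seqs (suc m) N) ≡ sumBelow N (λ a → countB (λ β → P (suc a ∷ β)) (seqs m N))
countB-seqs-suc P m N = go N suc
  where
  go : ∀ K (f : ℕ → ℕ) →
       countB P (concatMap (λ a → map (a ∷_) (seqs m N)) (applyUpTo f K))
       ≡ sumBelow K (λ a → countB (λ β → P (f a ∷ β)) (seqs m N))
  go zero    f = refl
  go (suc K) f = trans (countB-++ P (map (f 0 ∷_) (seqs m N)) _)
                       (cong₂ _+_ (countB-map-∷ P (f 0) (seqs m N)) (go K (λ a → f (suc a))))

Seq : ℕ → ℕ → List ℕ → Set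
Seq m N α = (length α ≡ m) × (allLe N α ≡ true)

seqs-ext : ∀ m N P Q → (∀ α → Seq m N α → P α ≡ Q α) → countB P (seqs m N) ≡ countB Q (seqs m N)
seqs-ext zero    N P Q h = cong (λ b → [ b ] + 0) (h [] (refl , refl))
seqs-ext (suc m) N P Q h = begin
  countB P (seqs (suc m) N)                                   ≡⟨ countB-seqs-suc P m N ⟩
  sumBelow N (λ a → countB (λ β → P (suc a ∷ β)) (seqs m N))  ≡⟨ sumBelow-ext N _ _ tails ⟩
  sumBelow N (λ a → countB (λ β → Q (suc a ∷ β)) (seqs m N))  ≡⟨ countB-seqs-suc Q m N ⟨
  countB Q (seqs (suc m) N)                                   ∎
  where
  open ≡-Reasoning
  tails : ∀ a → a < N →
          countB (λ β → P (suc a ∷ β)) (seqs m N) ≡ countB (λ β → Q (suc a ∷ β)) (seqs m N)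
  tails a a<N = seqs-ext m N _ _ (λ β (len , max) → h (suc a ∷ β) (cong suc len , allLe-∷ β a<N max))

seqs-shrink : ∀ m N v P → v ≤ N → (∀ α → P α ≡ true → allLe v α ≡ true) →
              countB P (seqs m N) ≡ countB P (seqs m v)
seqs-shrink zero    N v P v≤N h = refl
seqs-shrink (suc m) N v P v≤N h = begin
  countB P (seqs (suc m) N)                                   ≡⟨ countB-seqs-suc P m N ⟩
  sumBelow N (λ a → countB (λ β → P (suc a ∷ β)) (seqs m N))  ≡⟨ sumBelow-truncate N v _ v≤N too-big ⟩
  sumBelow v (λ a → countB (λ β → P (suc a ∷ β)) (seqs m N))  ≡⟨ sumBelow-ext v _ _ tails ⟩
  sumBelow v (λ a → countB (λ β → P (suc a ∷ β)) (seqs m v))  ≡⟨ countB-seqs-suc P m v ⟨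
  countB P (seqs (suc m) v)                                   ∎
  where
  open ≡-Reasoning
  too-big : ∀ a → v ≤ a → a < N → countB (λ β → P (suc a ∷ β)) (seqs m N) ≡ 0
  too-big a v≤a _ = countB-false _ (seqs m N) never
    where
    never : ∀ β → P (suc a ∷ β) ≡ false
    never β with P (suc a ∷ β) in e
    ... | true  = ⊥-elim (<⇒≱ (s≤s v≤a) (proj₁ (allLe-cons v (suc a) β (h (suc a ∷ β) e))))
    ... | false = refl
  tails : ∀ a → a < v →
          countB (λ β → P (suc a ∷ β)) (seqs m N) ≡ countB (λ β → P (suc a ∷ β)) (seqs m v)
  tails a _ = seqs-shrink m N v _ v≤N (λ β e → proj₂ (allLe-cons v (suc a) β (h (suc a ∷ β) e)))

seqs-first : ∀ m N l P → 1 ≤ l → l ≤ N → (∀ a β → a ≢ l → P (a ∷ β) ≡ false) →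
             countB P (seqs (suc m) N) ≡ countB (λ β → P (l ∷ β)) (seqs m N)
seqs-first m N (suc l) P _ l<N h = begin
  countB P (seqs (suc m) N)                                    ≡⟨ countB-seqs-suc P m N ⟩
  sumBelow N (λ a → countB (λ β → P (suc a ∷ β)) (seqs m N))   ≡⟨ sumBelow-pick N l _ l<N ⟩
  countB (λ β → P (suc l ∷ β)) (seqs m N) + sumBelow N others  ≡⟨ cong (_+_ _) (sumBelow-zero N others vanish) ⟩
  countB (λ β → P (suc l ∷ β)) (seqs m N) + 0                  ≡⟨ +-identityʳ _ ⟩
  countB (λ β → P (suc l ∷ β)) (seqs m N)                      ∎
  where
  open ≡-Reasoning
  others : ℕ → ℕ
  others a = if a ≡ᵇ l then 0 else countB (λ β → P (suc a ∷ β)) (seqs m N)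
  vanish : ∀ a → a < N → others a ≡ 0
  vanish a _ with a ≟ l
  ... | yes refl rewrite ≡ᵇ-refl a = refl
  ... | no a≢l rewrite ≢⇒≡ᵇ-false a≢l =
    countB-false _ (seqs m N) (λ β → h (suc a) β (λ e → a≢l (suc-injective e)))

sum1 : ℕ → (ℕ → ℕ) → ℕ
sum1 zero    g = 0
sum1 (suc K) g = sum1 K g + g (suc K)

sum1-ext : ∀ K g h → (∀ i → 1 ≤ i → i ≤ K → g i ≡ h i) → sum1 K g ≡ sum1 K h
sum1-ext zero    g h e = refl
sum1-ext (suc K) g h e =
  cong₂ _+_ (sum1-ext K g h (λ i p q → e i p (m≤n⇒m≤1+n q))) (e (suc K) (s≤s z≤n) ≤-refl)

countB-split : ∀ (P c : List ℕ → Bool) (xs : List (List ℕ)) →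
  countB P xs ≡ countB (λ x → P x ∧ c x) xs + countB (λ x → P x ∧ not (c x)) xs
countB-split P c [] = refl
countB-split P c (x ∷ xs) =
  trans (cong₂ _+_ (pointwise (P x) (c x)) (countB-split P c xs))
        (interchange [ P x ∧ c x ] [ P x ∧ not (c x) ] _ _)
  where
  pointwise : ∀ a b → [ a ] ≡ [ a ∧ b ] + [ a ∧ not b ]
  pointwise true  true  = refl
  pointwise true  false = refl
  pointwise false b     = refl

countB-by-value : ∀ (f : List ℕ → ℕ) (Q : List ℕ → Bool) K (xs : List (List ℕ)) →
  countB (λ x → (f x ≤ᵇ K) ∧ Q x) xs
  ≡ countB (λ x → (f x ≡ᵇ 0) ∧ Q x) xs + sum1 K (λ i → countB (λ x → (f x ≡ᵇ i) ∧ Q x) xs)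
countB-by-value f Q zero xs = trans (countB-cong _ _ xs (λ x → le0 (f x) (Q x))) (sym (+-identityʳ _))
  where
  le0 : ∀ c q → ((c ≤ᵇ 0) ∧ q) ≡ ((c ≡ᵇ 0) ∧ q)
  le0 zero    q = refl
  le0 (suc c) q = refl
countB-by-value f Q (suc K) xs = begin
  count≤ (suc K)                                         ≡⟨ split-last xs ⟩
  count≤ K + count≡ (suc K)                              ≡⟨ cong (_+ count≡ (suc K)) (countB-by-value f Q K xs) ⟩
  count≡ 0 + sum1 K count≡ + count≡ (suc K)              ≡⟨ +-assoc (count≡ 0) _ _ ⟩
  count≡ 0 + sum1 (suc K) count≡                         ∎
  where
  open ≡-Reasoning
  count≤ count≡ : ℕ → ℕ
  count≤ J = countB (λ x → (f x ≤ᵇ J) ∧ Q x) xs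
  count≡ i = countB (λ x → (f x ≡ᵇ i) ∧ Q x) xs
  pointwise : ∀ c q → [ (c ≤ᵇ suc K) ∧ q ] ≡ [ (c ≤ᵇ K) ∧ q ] + [ (c ≡ᵇ suc K) ∧ q ]
  pointwise c q with c ≤? K | c ≟ suc K
  ... | yes c≤K | _ rewrite ≤⇒≤ᵇ-true c≤K | ≤⇒≤ᵇ-true (m≤n⇒m≤1+n c≤K)
                          | ≢⇒≡ᵇ-false {c} {suc K} (λ e → <-irrefl e (s≤s c≤K)) = sym (+-identityʳ _)
  ... | no _ | yes refl rewrite ≤⇒≤ᵇ-true (≤-refl {suc K}) | >⇒≤ᵇ-false (≤-refl {suc K})
                          | ≡ᵇ-refl K = refl
  ... | no c≰K | no c≢1+K rewrite >⇒≤ᵇ-false (≰⇒> c≰K) | ≢⇒≡ᵇ-false c≢1+K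
                          | >⇒≤ᵇ-false (≤∧≢⇒< (≰⇒> c≰K) (λ e → c≢1+K (sym e))) = refl
  split-last : ∀ ys → countB (λ x → (f x ≤ᵇ suc K) ∧ Q x) ys
                      ≡ countB (λ x → (f x ≤ᵇ K) ∧ Q x) ys + countB (λ x → (f x ≡ᵇ suc K) ∧ Q x) ys
  split-last [] = refl
  split-last (y ∷ ys) = trans (cong₂ _+_ (pointwise (f y) (Q y)) (split-last ys))
                              (interchange [ (f y ≤ᵇ K) ∧ Q y ] [ (f y ≡ᵇ suc K) ∧ Q y ] _ _)

-- Fix a value v = u + 1 ∈ [N].  Choosing the i
-- positions of the v's and then a v-free sequence for the other m - i
-- positions shows that #{α ∈ [N]ᵐ : α has i entries v, R (erase v α)} is
-- C(m,i) times #{β ∈ [N]^(m-i) : v ∉ β, R β}.  The proof is by induction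
-- on m, classifying sequences by their first entry (Pascal's rule).
module BinomialCount (N u : ℕ) (u<N : u < N) where
  v : ℕ
  v = suc u

  avoiding : ℕ → (List ℕ → Bool) → ℕ
  avoiding L R = countB (λ β → not (someEq v β) ∧ R β) (seqs L N)

  withMult : ℕ → ℕ → (List ℕ → Bool) → ℕ
  withMult m i R = countB (λ α → (mult v α ≡ᵇ i) ∧ R (erase v α)) (seqs m N)

  avoiding-suc : ∀ L R →
    avoiding (suc L) R ≡ sumBelow N (λ a → if a ≡ᵇ u then 0 else avoiding L (λ β → R (suc a ∷ β)))
  avoiding-suc L R = trans (countB-seqs-suc _ L N) (sumBelow-ext N _ _ first-entry)
    where
    first-entry : ∀ a → a < N →
      countB (λ β → not (someEq v (suc a ∷ β)) ∧ R (suc a ∷ β)) (seqs L N)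
      ≡ (if a ≡ᵇ u then 0 else avoiding L (λ β → R (suc a ∷ β)))
    first-entry a _ with a ≡ᵇ u
    ... | true  = countB-false _ (seqs L N) (λ _ → refl)
    ... | false = refl

  binomial : ∀ m i R → withMult m i R ≡ (m C i) * avoiding (m ∸ i) R
  binomial zero    zero    R = sym (*-identityˡ _)
  binomial zero    (suc i) R = refl
  binomial (suc m) i R = begin
    withMult (suc m) i R                                  ≡⟨ countB-seqs-suc _ m N ⟩
    sumBelow N byFirst                                    ≡⟨ sumBelow-pick N u byFirst u<N ⟩
    byFirst u + sumBelow N (λ a → if a ≡ᵇ u then 0 else byFirst a)
                                                          ≡⟨ cong₂ _+_ (v-first i) others ⟩
    vFirst i + (m C i) * avoiding (suc (m ∸ i)) R         ≡⟨ pascal i ⟩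
    (suc m C i) * avoiding (suc m ∸ i) R                  ∎
    where
    open ≡-Reasoning
    byFirst : ℕ → ℕ
    byFirst a = countB (λ α → (mult v (suc a ∷ α) ≡ᵇ i) ∧ R (erase v (suc a ∷ α))) (seqs m N)

    -- Sequences v ∷ α need i - 1 further v's (and there are none for i = 0).
    vFirst : ℕ → ℕ
    vFirst zero     = 0
    vFirst (suc i') = withMult m i' R

    v-first : ∀ i → countB (λ α → (mult v (v ∷ α) ≡ᵇ i) ∧ R (erase v (v ∷ α))) (seqs m N) ≡ vFirst i
    v-first zero    rewrite ≡ᵇ-refl u = countB-false _ (seqs m N) (λ _ → refl)
    v-first (suc i) rewrite ≡ᵇ-refl u = refl

    others : sumBelow N (λ a → if a ≡ᵇ u then 0 else byFirst a) ≡ (m C i) * avoiding (suc (m ∸ i)) R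
    others = begin
      sumBelow N (λ a → if a ≡ᵇ u then 0 else byFirst a)
        ≡⟨ sumBelow-ext N _ _ (λ a _ → not-v a) ⟩
      sumBelow N (λ a → (m C i) * (if a ≡ᵇ u then 0 else avoiding (m ∸ i) (λ β → R (suc a ∷ β))))
        ≡⟨ sumBelow-*ˡ N (m C i) _ ⟩
      (m C i) * sumBelow N (λ a → if a ≡ᵇ u then 0 else avoiding (m ∸ i) (λ β → R (suc a ∷ β)))
        ≡⟨ cong (_*_ (m C i)) (avoiding-suc (m ∸ i) R) ⟨
      (m C i) * avoiding (suc (m ∸ i)) R ∎
      where
      not-v : ∀ a → (if a ≡ᵇ u then 0 else byFirst a)
                    ≡ (m C i) * (if a ≡ᵇ u then 0 else avoiding (m ∸ i) (λ β → R (suc a ∷ β)))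
      not-v a with a ≡ᵇ u
      ... | true  = sym (*-zeroʳ (m C i))
      ... | false = binomial m i (λ β → R (suc a ∷ β))

    pascal : ∀ i → vFirst i + (m C i) * avoiding (suc (m ∸ i)) R ≡ (suc m C i) * avoiding (suc m ∸ i) R
    pascal zero     = refl
    pascal (suc i') = begin
      withMult m i' R + (m C suc i') * avoiding (suc (m ∸ suc i')) R
        ≡⟨ cong₂ _+_ (binomial m i' R) shift ⟩
      (m C i') * avoiding (m ∸ i') R + (m C suc i') * avoiding (m ∸ i') R
        ≡⟨ *-distribʳ-+ (avoiding (m ∸ i') R) (m C i') (m C suc i') ⟨
      (m C i' + m C suc i') * avoiding (m ∸ i') R
        ≡⟨ cong (_* avoiding (m ∸ i') R) (nCk+nC[k+1]≡[n+1]C[k+1] m i') ⟩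
      (suc m C suc i') * avoiding (m ∸ i') R ∎
      where
      shift : (m C suc i') * avoiding (suc (m ∸ suc i')) R ≡ (m C suc i') * avoiding (m ∸ i') R
      shift with suc i' ≤? m
      ... | yes i'<m = cong (λ L → (m C suc i') * avoiding L R) (sym (+-∸-assoc 1 i'<m))
      ... | no i'≮m rewrite k>n⇒nCk≡0 {m} {suc i'} (≰⇒> i'≮m) = refl

  count-by-multiplicity : ∀ m K R →
    countB (λ α → (mult v α ≤ᵇ K) ∧ R (erase v α)) (seqs m N)
    ≡ avoiding m R + sum1 K (λ i → (m C i) * avoiding (m ∸ i) R)
  count-by-multiplicity m K R = trans (countB-by-value (mult v) (λ α → R (erase v α)) K (seqs m N))
    (cong₂ _+_ (trans (binomial m 0 R) (*-identityˡ _)) (sum1-ext K _ _ (λ i _ _ → binomial m i R)))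

allLe-suc : ∀ t γ → (allLe (suc t) γ ∧ not (someEq (suc t) γ)) ≡ allLe t γ
allLe-suc t [] = refl
allLe-suc t (a ∷ γ) with a ≟ suc t
... | yes refl rewrite ≡ᵇ-refl a | >⇒≤ᵇ-false (n<1+n t) = ∧-zeroʳ _
... | no a≢1+t rewrite ≢⇒≡ᵇ-false a≢1+t with a ≤? t
...   | yes a≤t rewrite ≤⇒≤ᵇ-true a≤t | ≤⇒≤ᵇ-true (m≤n⇒m≤1+n a≤t) = allLe-suc t γ
...   | no a≰t rewrite >⇒≤ᵇ-false (≰⇒> a≰t)
                     | >⇒≤ᵇ-false (≤∧≢⇒< (≰⇒> a≰t) (λ e → a≢1+t (sym e))) = refl

allLe-without-max : ∀ t γ → allLe (suc t) γ ≡ true → someEq (suc t) γ ≡ false → allLe t γ ≡ true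
allLe-without-max t γ e f = trans (sym (allLe-suc t γ)) (cong₂ (λ x y → x ∧ not y) e f)

someEq-above : ∀ t w β → allLe t β ≡ true → t < w → someEq w β ≡ false
someEq-above t w []      e t<w = refl
someEq-above t w (a ∷ β) e t<w with allLe-cons t a β e
... | a≤t , e' rewrite ≢⇒≡ᵇ-false {a} {w} (λ a≡w → <⇒≱ t<w (subst (_≤ t) a≡w a≤t)) =
  someEq-above t w β e' t<w

allLe-erase : ∀ t v β → allLe t β ≡ true → allLe t (erase v β) ≡ true
allLe-erase t v []      e = refl
allLe-erase t v (a ∷ β) e with allLe-cons t a β e | a ≡ᵇ v
... | a≤t , e' | true  = allLe-erase t v β e'
... | a≤t , e' | false = allLe-∷ (erase v β) a≤t (allLe-erase t v β e')

someEq-erase-self : ∀ v β → someEq v (erase v β) ≡ false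
someEq-erase-self v [] = refl
someEq-erase-self v (a ∷ β) with a ≡ᵇ v in e
... | true  = someEq-erase-self v β
... | false rewrite e = someEq-erase-self v β

someEq-erase-other : ∀ w v β → w ≢ v → someEq w (erase v β) ≡ someEq w β
someEq-erase-other w v [] w≢v = refl
someEq-erase-other w v (a ∷ β) w≢v with a ≟ v
... | yes refl rewrite ≡ᵇ-refl a | ≢⇒≡ᵇ-false {a} {w} (λ e → w≢v (sym e)) = someEq-erase-other w a β w≢v
... | no a≢v rewrite ≢⇒≡ᵇ-false a≢v = cong (_∨_ (a ≡ᵇ w)) (someEq-erase-other w v β w≢v)

allLe-erase-max : ∀ s β → allLe (suc s) β ≡ true → allLe s (erase (suc s) β) ≡ true
allLe-erase-max s β e =
  allLe-without-max s (erase (suc s) β) (allLe-erase (suc s) (suc s) β e) (someEq-erase-self (suc s) β)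

erase-top : ∀ t β → allLe (suc (suc t)) β ≡ true →
            allLe t (erase (suc (suc t)) β) ≡ not (someEq (suc t) β)
erase-top t β e = begin
  allLe t γ                                                  ≡⟨ allLe-suc t γ ⟨
  allLe (suc t) γ ∧ not (someEq (suc t) γ)                   ≡⟨ cong₂ (λ x y → x ∧ not y)
                                                                  (allLe-erase-max (suc t) β e)
                                                                  (someEq-erase-other (suc t) (suc (suc t)) β (λ ())) ⟩
  not (someEq (suc t) β)                                     ∎
  where
  open ≡-Reasoning
  γ = erase (suc (suc t)) β

erase-second-top : ∀ t β → allLe (suc (suc t)) β ≡ true →
                   allLe t (erase (suc t) β) ≡ not (someEq (suc (suc t)) β)
erase-second-top t β e = begin
  allLe t γ                                                  ≡⟨ allLe-suc t γ ⟨
  allLe (suc t) γ ∧ not (someEq (suc t) γ)                   ≡⟨ cong (λ y → allLe (suc t) γ ∧ not y)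
                                                                  (someEq-erase-self (suc t) β) ⟩
  allLe (suc t) γ ∧ true                                     ≡⟨ ∧-identityʳ _ ⟩
  allLe (suc t) γ                                            ≡⟨ allLe-suc (suc t) γ ⟨
  allLe (suc (suc t)) γ ∧ not (someEq (suc (suc t)) γ)       ≡⟨ cong₂ (λ x y → x ∧ not y)
                                                                  (allLe-erase (suc (suc t)) (suc t) β e)
                                                                  (someEq-erase-other (suc (suc t)) (suc t) β (λ ())) ⟩
  not (someEq (suc (suc t)) β)                               ∎
  where
  open ≡-Reasoning
  γ = erase (suc t) β

isPF⇒allLe : ∀ m β → isPF m β ≡ true → allLe m β ≡ true
isPF⇒allLe m β e = none-above β no-car-above
  where
  no-car-above : atLeast (suc m) β ≡ 0
  no-car-above with atLeast (suc m) β in c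
  ... | zero  = refl
  ... | suc x = ⊥-elim (<⇒≱ (m<n+m (suc m) z<s)
                  (subst (λ y → y + suc m ≤ suc m) c (isPF⇒Fits m β e (suc m) (subst (0 <_) (sym c) z<s))))
  none-above : ∀ β → atLeast (suc m) β ≡ 0 → allLe m β ≡ true
  none-above [] _ = refl
  none-above (a ∷ β) z with suc m ≤? a
  ... | yes m<a rewrite atLeast-≥ β m<a = ⊥-elim (1+n≢0 z)
  ... | no m≮a rewrite atLeast-< β (≰⇒> m≮a) = allLe-∷ β (≤-pred (≰⇒> m≮a)) (none-above β z)

p⁼-as-tails : ∀ m t l → 1 ≤ l → l ≤ suc m →
  p⁼ (suc m) t l
  ≡ countB (λ β → isPF (suc m) (l ∷ β) ∧ (allLe t (l ∷ β) ∧ someEq t (l ∷ β))) (seqs m (suc m))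
p⁼-as-tails m t l 1≤l l≤1+m = begin
  p⁼ (suc m) t l
    ≡⟨ countB-filterB P (isPF (suc m)) (seqs (suc m) (suc m)) ⟩
  countB (λ α → isPF (suc m) α ∧ P α) (seqs (suc m) (suc m))
    ≡⟨ seqs-first m (suc m) l _ 1≤l l≤1+m first-l ⟩
  countB (λ β → isPF (suc m) (l ∷ β) ∧ P (l ∷ β)) (seqs m (suc m))
    ≡⟨ countB-cong _ _ (seqs m (suc m)) first-is-l ⟩
  countB (λ β → isPF (suc m) (l ∷ β) ∧ (allLe t (l ∷ β) ∧ someEq t (l ∷ β))) (seqs m (suc m)) ∎
  where
  open ≡-Reasoning
  P : List ℕ → Bool
  P α = firstIs l α ∧ allLe t α ∧ someEq t α
  first-l : ∀ a β → a ≢ l → (isPF (suc m) (a ∷ β) ∧ P (a ∷ β)) ≡ false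
  first-l a β a≢l rewrite ≢⇒≡ᵇ-false a≢l = ∧-zeroʳ _
  first-is-l : ∀ β → (isPF (suc m) (l ∷ β) ∧ P (l ∷ β))
                     ≡ (isPF (suc m) (l ∷ β) ∧ (allLe t (l ∷ β) ∧ someEq t (l ∷ β)))
  first-is-l β rewrite ≡ᵇ-refl l = refl

p⁼-below-max : ∀ m t l W → 1 ≤ l → l < t → t ≤ W → W ≤ suc m →
  p⁼ (suc m) t l ≡ countB (λ β → isPF (suc m) (l ∷ β) ∧ (allLe t β ∧ someEq t β)) (seqs m W)
p⁼-below-max m t l W 1≤l l<t t≤W W≤1+m = begin
  p⁼ (suc m) t l             ≡⟨ p⁼-as-tails m t l 1≤l (≤-trans (<⇒≤ l<t) (≤-trans t≤W W≤1+m)) ⟩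
  countB _ (seqs m (suc m))  ≡⟨ countB-cong _ Q (seqs m (suc m)) l-below-t ⟩
  countB Q (seqs m (suc m))  ≡⟨ seqs-shrink m (suc m) W Q W≤1+m entries≤W ⟩
  countB Q (seqs m W)        ∎
  where
  open ≡-Reasoning
  Q : List ℕ → Bool
  Q β = isPF (suc m) (l ∷ β) ∧ (allLe t β ∧ someEq t β)
  l-below-t : ∀ β → (isPF (suc m) (l ∷ β) ∧ (allLe t (l ∷ β) ∧ someEq t (l ∷ β))) ≡ Q β
  l-below-t β rewrite ≤⇒≤ᵇ-true (<⇒≤ l<t) | ≢⇒≡ᵇ-false (<⇒≢ l<t) = refl
  entries≤W : ∀ β → Q β ≡ true → allLe W β ≡ true
  entries≤W β e = allLe-mono β t≤W (proj₁ (∧-true (proj₂ (∧-true {isPF (suc m) (l ∷ β)} e))))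

p⁼-max-first : ∀ m s → 1 ≤ s → s ≤ suc m →
  p⁼ (suc m) s s ≡ countB (λ β → isPF m β ∧ allLe s β) (seqs m m)
p⁼-max-first m s 1≤s s≤1+m = begin
  p⁼ (suc m) s s             ≡⟨ p⁼-as-tails m s s 1≤s s≤1+m ⟩
  countB _ (seqs m (suc m))  ≡⟨ seqs-ext m (suc m) _ Q (λ β _ → tail-condition β) ⟩
  countB Q (seqs m (suc m))  ≡⟨ seqs-shrink m (suc m) m Q (n≤1+n m) entries≤m ⟩
  countB Q (seqs m m)        ∎
  where
  open ≡-Reasoning
  Q : List ℕ → Bool
  Q β = isPF m β ∧ allLe s β
  tail-condition : ∀ β → (isPF (suc m) (s ∷ β) ∧ (allLe s (s ∷ β) ∧ someEq s (s ∷ β))) ≡ Q β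
  tail-condition β rewrite ≡ᵇ-refl s | ≤⇒≤ᵇ-true (≤-refl {s}) with allLe s β in max
  ... | true  = trans (∧-identityʳ _) (trans (isPF-max-first m s β s≤1+m max) (sym (∧-identityʳ _)))
  ... | false = trans (∧-zeroʳ _) (sym (∧-zeroʳ _))
  entries≤m : ∀ β → Q β ≡ true → allLe m β ≡ true
  entries≤m β e = isPF⇒allLe m β (proj₁ (∧-true {isPF m β} e))

part1 : (n : ℕ) → 1 ≤ n → p⁼ n n n ≡ p (n ∸ 1)
part1 (suc m) _ = begin
  p⁼ (suc m) (suc m) (suc m)                           ≡⟨ p⁼-max-first m (suc m) (s≤s z≤n) ≤-refl ⟩
  countB (λ β → isPF m β ∧ allLe (suc m) β) (seqs m m) ≡⟨ seqs-ext m m _ _ automatic ⟩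
  countB (λ β → isPF m β ∧ true) (seqs m m)            ≡⟨ countB-filterB (λ _ → true) (isPF m) (seqs m m) ⟨
  p m                                                  ∎
  where
  open ≡-Reasoning
  automatic : ∀ β → Seq m m β → (isPF m β ∧ allLe (suc m) β) ≡ (isPF m β ∧ true)
  automatic β (_ , max) = cong (_∧_ (isPF m β)) (allLe-mono β (n≤1+n m) max)

part2 : (k n : ℕ) → 1 ≤ k → k + 1 ≤ n → p⁼ n (n ∸ k) (n ∸ k) ≡ p≤ (n ∸ 1) (n ∸ k)
part2 (suc k) zero _ ()
part2 k (suc m) _ k+1≤n = trans (p⁼-max-first m (suc m ∸ k) 1≤n-k (m∸n≤m (suc m) k))
  (sym (countB-filterB (allLe (suc m ∸ k)) (isPF m) (seqs m m)))
  where
  1≤n-k : 1 ≤ suc m ∸ k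
  1≤n-k = m<n⇒0<n∸m (subst (_≤ suc m) (+-comm k 1) k+1≤n)

-- Part three, for n = m + 1 with m = t + k, s = t + 1 = n - k, W = s + 1
-- and 1 ≤ l ≤ t.  All counts run over tails β ∈ [W]ᵐ of parking functions
-- l ∷ β of length n (such tails have entries ≤ W, so nothing is lost).
module PartThree (u k l : ℕ) (1≤k : 1 ≤ k) (1≤l : 1 ≤ l) (l≤t : l ≤ suc u) where
  t s W m n : ℕ
  t = suc u
  s = suc t
  W = suc s
  m = t + k
  n = suc m

  pf : List ℕ → Bool
  pf β = isPF n (l ∷ β)

  count : (List ℕ → Bool) → ℕ
  count P = countB P (seqs m W)

  pf-rest maxIsS maxBelowS : List ℕ → Bool
  pf-rest   γ = isPF (suc (length γ)) (l ∷ γ)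
  maxIsS    γ = pf-rest γ ∧ (allLe s γ ∧ someEq s γ)
  maxBelowS γ = pf-rest γ ∧ allLe t γ

  module ByW = BinomialCount W s ≤-refl
  module ByS = BinomialCount W t (n≤1+n s)

  l<s : l < s
  l<s = s≤s l≤t

  erase-pf : ∀ v K β → Seq m W β → l < v → allLe v β ≡ true → v + K ≡ suc n →
             ((mult v β ≤ᵇ K) ∧ pf-rest (erase v β)) ≡ pf β
  erase-pf v K β (len , _) l<v max v+K =
    subst (λ L → ((mult v β ≤ᵇ K) ∧ pf-rest (erase v β)) ≡ isPF (suc L) (l ∷ β)) len
      (isPF-erase-tail v l β K l<v max (trans v+K (cong (λ L → suc (suc L)) (sym len))))

  erase-W : ∀ β → Seq m W β → ((mult W β ≤ᵇ k) ∧ pf-rest (erase W β)) ≡ pf β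
  erase-W β sq@(_ , max) = erase-pf W k β sq (m<n⇒m<1+n l<s) max refl

  ∧-reassoc : ∀ c x e y → (c ∧ x) ≡ y → (c ∧ (x ∧ e)) ≡ (y ∧ e)
  ∧-reassoc c x e y h = trans (sym (∧-assoc c x e)) (cong (_∧ e) h)

  erase-W-withS : ∀ β → Seq m W β → ((mult W β ≤ᵇ k) ∧ maxIsS (erase W β)) ≡ (pf β ∧ someEq s β)
  erase-W-withS β sq@(_ , max) rewrite allLe-erase-max s β max | someEq-erase-other s W β (λ ()) =
    ∧-reassoc (mult W β ≤ᵇ k) (pf-rest (erase W β)) (someEq s β) (pf β) (erase-W β sq)

  erase-W-withoutS : ∀ β → Seq m W β →
                     ((mult W β ≤ᵇ k) ∧ maxBelowS (erase W β)) ≡ (pf β ∧ not (someEq s β))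
  erase-W-withoutS β sq@(_ , max) rewrite erase-top t β max =
    ∧-reassoc (mult W β ≤ᵇ k) (pf-rest (erase W β)) (not (someEq s β)) (pf β) (erase-W β sq)

  erase-s-withoutW : ∀ β → Seq m W β →
                     ((mult s β ≤ᵇ suc k) ∧ maxBelowS (erase s β)) ≡ (pf β ∧ not (someEq W β))
  erase-s-withoutW β sq@(_ , max) rewrite erase-second-top t β max with someEq W β in W∈β
  ... | true  = trans (∧-∧-false (mult s β ≤ᵇ suc k) (pf-rest (erase s β))) (sym (∧-zeroʳ (pf β)))
  ... | false = ∧-reassoc (mult s β ≤ᵇ suc k) (pf-rest (erase s β)) true (pf β)
                  (erase-pf s (suc k) β sq l<s (allLe-without-max s β max W∈β) (cong suc (+-suc t k)))

  withS withoutS withW withoutW : ℕ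
  withS    = count (λ β → pf β ∧ someEq s β)
  withoutS = count (λ β → pf β ∧ not (someEq s β))
  withW    = count (λ β → pf β ∧ someEq W β)
  withoutW = count (λ β → pf β ∧ not (someEq W β))

  two-splits : withS + withoutS ≡ withW + withoutW
  two-splits = trans (sym (countB-split pf (someEq s) (seqs m W))) (countB-split pf (someEq W) (seqs m W))

  withS-by-W : withS ≡ ByW.avoiding m maxIsS + sum1 k (λ i → (m C i) * ByW.avoiding (m ∸ i) maxIsS)
  withS-by-W = trans (sym (seqs-ext m W _ _ erase-W-withS)) (ByW.count-by-multiplicity m k maxIsS)

  withoutS-by-W : withoutS ≡ ByW.avoiding m maxBelowS + sum1 k (λ i → (m C i) * ByW.avoiding (m ∸ i) maxBelowS)
  withoutS-by-W = trans (sym (seqs-ext m W _ _ erase-W-withoutS)) (ByW.count-by-multiplicity m k maxBelowS)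

  withoutW-by-s : withoutW
                  ≡ ByS.avoiding m maxBelowS + sum1 (suc k) (λ i → (m C i) * ByS.avoiding (m ∸ i) maxBelowS)
  withoutW-by-s = trans (sym (seqs-ext m W _ _ erase-s-withoutW)) (ByS.count-by-multiplicity m (suc k) maxBelowS)

  avoiding-s≡avoiding-W : ∀ L → ByS.avoiding L maxBelowS ≡ ByW.avoiding L maxBelowS
  avoiding-s≡avoiding-W L = countB-cong _ _ (seqs L W) pointwise
    where
    pointwise : ∀ β → (not (someEq s β) ∧ maxBelowS β) ≡ (not (someEq W β) ∧ maxBelowS β)
    pointwise β with allLe t β in max
    ... | true rewrite someEq-above t s β max (n<1+n t) | someEq-above t W β max (m<n⇒m<1+n (n<1+n t)) = refl
    ... | false = trans (∧-∧-false (not (someEq s β)) (pf-rest β))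
                        (sym (∧-∧-false (not (someEq W β)) (pf-rest β)))

  s≤m : s ≤ m
  s≤m = subst (_≤ t + k) (+-comm t 1) (+-monoʳ-≤ t 1≤k)

  withW≡p⁼ : withW ≡ p⁼ n W l
  withW≡p⁼ = sym (trans (p⁼-below-max m W l W 1≤l (m<n⇒m<1+n l<s) ≤-refl (s≤s s≤m))
                        (seqs-ext m W _ _ (λ β (_ , max) → cong (λ b → pf β ∧ (b ∧ someEq W β)) max)))

  avoiding-maxIsS : ∀ i → i ≤ k → ByW.avoiding (m ∸ i) maxIsS ≡ p⁼ (n ∸ i) s l
  avoiding-maxIsS i i≤k = begin
    ByW.avoiding (m ∸ i) maxIsS    ≡⟨ seqs-ext (m ∸ i) W _ Q W-free ⟩
    countB Q (seqs (m ∸ i) W)      ≡⟨ seqs-shrink (m ∸ i) W s Q (n≤1+n s) entries≤s ⟩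
    countB Q (seqs (m ∸ i) s)      ≡⟨ p⁼-below-max (m ∸ i) s l s 1≤l l<s ≤-refl s≤1+m-i ⟨
    p⁼ (suc (m ∸ i)) s l           ≡⟨ cong (λ x → p⁼ x s l) (+-∸-assoc 1 (≤-trans i≤k (m≤n+m k t))) ⟨
    p⁼ (n ∸ i) s l                 ∎
    where
    open ≡-Reasoning
    Q : List ℕ → Bool
    Q β = isPF (suc (m ∸ i)) (l ∷ β) ∧ (allLe s β ∧ someEq s β)
    entries≤s : ∀ β → Q β ≡ true → allLe s β ≡ true
    entries≤s β e = proj₁ (∧-true (proj₂ (∧-true {isPF (suc (m ∸ i)) (l ∷ β)} e)))
    s≤1+m-i : s ≤ suc (m ∸ i)
    s≤1+m-i = s≤s (subst (_≤ m ∸ i) (m+n∸n≡m t k) (∸-monoʳ-≤ m i≤k))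
    W-free : ∀ β → Seq (m ∸ i) W β → (not (someEq W β) ∧ maxIsS β) ≡ Q β
    W-free β (len , _) rewrite len with allLe s β in max
    ... | true rewrite someEq-above s W β max (n<1+n s) = refl
    ... | false = trans (∧-∧-false (not (someEq W β)) (isPF (suc (m ∸ i)) (l ∷ β))) (sym (∧-zeroʳ _))

  avoiding-maxBelowS : ByS.avoiding (m ∸ suc k) maxBelowS ≡ pˡ t l
  avoiding-maxBelowS = begin
    ByS.avoiding (m ∸ suc k) maxBelowS                    ≡⟨ cong (λ L → ByS.avoiding L maxBelowS) (m+n∸n≡m u k) ⟩
    ByS.avoiding u maxBelowS                              ≡⟨ seqs-ext u W _ Q s-free ⟩
    countB Q (seqs u W)                                   ≡⟨ seqs-shrink u W t Q (m≤n⇒m≤1+n (n≤1+n t)) entries≤t ⟩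
    countB Q (seqs u t)                                   ≡⟨ seqs-ext u t Q _ first-is-l ⟩
    countB (λ β → isPF t (l ∷ β) ∧ firstIs l (l ∷ β)) (seqs u t)
                                                          ≡⟨ seqs-first u t l _ 1≤l l≤t other-first ⟨
    countB (λ α → isPF t α ∧ firstIs l α) (seqs t t)      ≡⟨ countB-filterB (firstIs l) (isPF t) (seqs t t) ⟨
    pˡ t l                                                ∎
    where
    open ≡-Reasoning
    Q : List ℕ → Bool
    Q β = isPF t (l ∷ β) ∧ allLe t β
    entries≤t : ∀ β → Q β ≡ true → allLe t β ≡ true
    entries≤t β e = proj₂ (∧-true {isPF t (l ∷ β)} e)
    s-free : ∀ β → Seq u W β → (not (someEq s β) ∧ maxBelowS β) ≡ Q β
    s-free β (len , _) rewrite len with allLe t β in max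
    ... | true rewrite someEq-above t s β max (n<1+n t) = refl
    ... | false = trans (∧-∧-false (not (someEq s β)) (isPF t (l ∷ β))) (sym (∧-zeroʳ _))
    first-is-l : ∀ β → Seq u t β → Q β ≡ (isPF t (l ∷ β) ∧ firstIs l (l ∷ β))
    first-is-l β (_ , max) rewrite max | ≡ᵇ-refl l = refl
    other-first : ∀ a β → a ≢ l → (isPF t (a ∷ β) ∧ firstIs l (a ∷ β)) ≡ false
    other-first a β a≢l rewrite ≢⇒≡ᵇ-false a≢l = ∧-zeroʳ _

  -- The identity of part three in ℕ: the two splittings share the summands
  -- counting tails with entries ≤ t.
  identity : p⁼ n s l + sum1 k (λ i → (m C i) * p⁼ (n ∸ i) s l) ≡ p⁼ n W l + (m C suc k) * pˡ t l
  identity = +-cancelʳ-≡ (a₀ + Tₜ) _ _ (begin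
    (p⁼ n s l + S) + (a₀ + Tₜ)    ≡⟨ cong₂ _+_ withS≡ withoutS-by-W ⟨
    withS + withoutS              ≡⟨ two-splits ⟩
    withW + withoutW              ≡⟨ cong₂ _+_ withW≡p⁼ withoutW≡ ⟩
    p⁼ n W l + (a₀ + (Tₜ + c))    ≡⟨ reorder (p⁼ n W l) a₀ Tₜ c ⟩
    (p⁼ n W l + c) + (a₀ + Tₜ)    ∎)
    where
    open ≡-Reasoning
    S Tₜ a₀ c : ℕ
    S  = sum1 k (λ i → (m C i) * p⁼ (n ∸ i) s l)
    Tₜ = sum1 k (λ i → (m C i) * ByW.avoiding (m ∸ i) maxBelowS)
    a₀ = ByW.avoiding m maxBelowS
    c  = (m C suc k) * pˡ t l
    reorder : ∀ e a x c → e + (a + (x + c)) ≡ (e + c) + (a + x)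
    reorder = solve-∀
    withS≡ : withS ≡ p⁼ n s l + S
    withS≡ = trans withS-by-W (cong₂ _+_ (avoiding-maxIsS 0 z≤n)
               (sum1-ext k _ _ (λ i _ i≤k → cong (_*_ (m C i)) (avoiding-maxIsS i i≤k))))
    withoutW≡ : withoutW ≡ a₀ + (Tₜ + c)
    withoutW≡ = trans withoutW-by-s (cong₂ _+_ (avoiding-s≡avoiding-W m)
                  (cong₂ _+_ (sum1-ext k _ _ (λ i _ _ → cong (_*_ (m C i)) (avoiding-s≡avoiding-W (m ∸ i))))
                             (cong (_*_ (m C suc k)) avoiding-maxBelowS)))

ℕ-identity⇒ℤ : ∀ a b c e → a + e ≡ b + c → + a ≡ (+ b +ℤ + c) - + e
ℕ-identity⇒ℤ a b c e a+e≡b+c = sym (begin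
  (+ b +ℤ + c) - + e      ≡⟨ cong (λ x → + x - + e) a+e≡b+c ⟨
  + (a + e) - + e         ≡⟨ ℤP.m-n≡m⊖n (a + e) e ⟩
  (a + e) ⊖ e             ≡⟨ ℤP.⊖-≥ (m≤n+m e a) ⟩
  + (a + e ∸ e)           ≡⟨ cong +_ (m+n∸n≡m a e) ⟩
  + a                     ∎)
  where open ≡-Reasoning

sumℤ1-+ : ∀ k (g : ℕ → ℕ) (f : ℕ → ℤ) → (∀ i → f i ≡ + g i) → sumℤ1 k f ≡ + sum1 k g
sumℤ1-+ zero    g f h = refl
sumℤ1-+ (suc k) g f h = cong₂ _+ℤ_ (sumℤ1-+ k g f h) (h (suc k))

-- Part three with n = (u + 2) + k, so that n - k = u + 2 and n - k - 1 = u + 1.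
part3-shifted : ∀ u k l → 1 ≤ k → 1 ≤ l → l ≤ suc u →
  + p⁼ (suc (suc u) + k) (suc (suc u)) l
  ≡ (+ p⁼ (suc (suc u) + k) (suc (suc (suc u))) l
     +ℤ (+ ((suc u + k) C (suc k)) *ℤ + pˡ (suc u) l))
    - sumℤ1 k (λ i → + ((suc u + k) C i) *ℤ + p⁼ (suc (suc u) + k ∸ i) (suc (suc u)) l)
part3-shifted u k l 1≤k 1≤l l≤t =
  trans (ℕ-identity⇒ℤ (p⁼ n s l) (p⁼ n W l) ((m C suc k) * pˡ t l) _ identity)
        (cong₂ _-_ (cong (_+ℤ_ (+ p⁼ n W l)) (ℤP.pos-* (m C suc k) (pˡ t l)))
                   (sym (sumℤ1-+ k _ _ (λ i → sym (ℤP.pos-* (m C i) (p⁼ (n ∸ i) s l))))))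
  where open PartThree u k l 1≤k 1≤l l≤t

split-≥k+2 : ∀ {k n} → k + 2 ≤ n → Σ ℕ (λ u → suc (suc u) + k ≡ n)
split-≥k+2 {k} k+2≤n with m≤n⇒∃[o]m+o≡n k+2≤n
... | u , k+2+u≡n = u , trans (reorder k u) k+2+u≡n
  where
  reorder : ∀ k u → suc (suc u) + k ≡ k + 2 + u
  reorder = solve-∀

part3 : (k n l : ℕ) → 1 ≤ k → k + 2 ≤ n → 1 ≤ l → l ≤ n ∸ k ∸ 1 →
  + p⁼ n (n ∸ k) l
  ≡ (+ p⁼ n (n ∸ k + 1) l +ℤ (+ ((n ∸ 1) C (k + 1)) *ℤ + pˡ (n ∸ k ∸ 1) l))
    - sumℤ1 k (λ i → + ((n ∸ 1) C i) *ℤ + p⁼ (n ∸ i) (n ∸ k) l)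
part3 k n l 1≤k k+2≤n 1≤l with split-≥k+2 k+2≤n
... | u , refl rewrite m+n∸n≡m (suc (suc u)) k | +-comm (suc (suc u)) 1 | +-comm k 1 =
  part3-shifted u k l 1≤k 1≤l

corollary2p17 :
    ((n : ℕ) → 1 ≤ n → p⁼ n n n ≡ p (n ∸ 1))
    × ((k n : ℕ) → 1 ≤ k → k + 1 ≤ n → p⁼ n (n ∸ k) (n ∸ k) ≡ p≤ (n ∸ 1) (n ∸ k))
    × ((k n l : ℕ) → 1 ≤ k → k + 2 ≤ n → 1 ≤ l → l ≤ n ∸ k ∸ 1 →
        + p⁼ n (n ∸ k) l
          ≡ (+ p⁼ n (n ∸ k + 1) l
             +ℤ (+ ((n ∸ 1) C (k + 1)) *ℤ + pˡ (n ∸ k ∸ 1) l))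
            - sumℤ1 k (λ i → + ((n ∸ 1) C i) *ℤ + p⁼ (n ∸ i) (n ∸ k) l))
corollary2p17 = part1 , part2 , part3
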